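{- Let $(e_k)_{k \ge 1}$ be a sequence of integers such that $e_1 \ge 1$ and $2^{e_k} > 10^{e_{k-1}}$ for all $k \ge 2$. Let $k \ge 1$, and suppose that $N$ is a positive integer which is divisible by $2^{e_k}$ but not by $10$. Then $c_{10}(N) \ge k$.
   Context: For an integer $b \ge 2$ and a nonnegative integer $N$, $c_b(N)$ denotes the number of nonzero digits in the base-$b$ expansion of $N$. -}

module Defs where

open import Data.Nat using (ℕ; zero; suc; _+_; _≡ᵇ_; NonZero)
open import Data.Nat.DivMod using (_/_; _%_)
open import Data.Bool using (if_then_else_)

-- Number of nonzero digits in the base-b expansion of n, computed with
-- a fuel parameter (fuel ≥ n suffices, since n / b < n for n > 0, b ≥ 2).
nzDigitsAux : (b : ℕ) → .{{_ : NonZero b}} → ℕ → ℕ → ℕ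
nzDigitsAux b zero    n = 0
nzDigitsAux b (suc f) zero = 0
nzDigitsAux b (suc f) n@(suc _) =
  (if (n % b) ≡ᵇ 0 then 0 else 1) + nzDigitsAux b f (n / b)

c : (b : ℕ) → .{{_ : NonZero b}} → ℕ → ℕ
c b n = nzDigitsAux b n n

-- Cut N at the position m = e_{k-1}: the remainder N mod 10^m is still a
-- multiple of 2^m (because 2^m ∣ 10^m) and still not a multiple of 10
-- (because 10 ∣ 10^m), so by induction it has at least k - 1 nonzero digits.
-- These are the last m digits of N, and N ≥ 2^{e_k} > 10^m forces at least
-- one more nonzero digit of N beyond position m.
module Submission where

open import Defs
open import Data.Bool using (if_then_else_)
open import Data.Nat
  using (ℕ; zero; suc; _+_; _*_; _∸_; _^_; _≤_; _<_; _≥_; _>_; _≡ᵇ_; z≤n; s≤s; NonZero; >-nonZero)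
open import Data.Nat.DivMod
open import Data.Nat.Divisibility
  using (_∣_; divides; ∣-refl; m∣m*n; ∣-trans; *-pres-∣; ∣⇒≤; %-presˡ-∣; ∣n∣m%n⇒∣m)
open import Data.Nat.Induction using (<-rec)
open import Data.Nat.Properties
open import Relation.Binary.PropositionalEquality
open import Relation.Nullary using (¬_; yes; no; contradiction)

^-monoˡ-∣ : ∀ {m n} k → m ∣ n → m ^ k ∣ n ^ k
^-monoˡ-∣ zero    m∣n = ∣-refl
^-monoˡ-∣ (suc k) m∣n = *-pres-∣ m∣n (^-monoˡ-∣ k m∣n)

^-monoʳ-∣ : ∀ m {j k} → j ≤ k → m ^ j ∣ m ^ k
^-monoʳ-∣ m {k = k} z≤n = divides (m ^ k) (sym (*-identityʳ (m ^ k)))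
^-monoʳ-∣ m (s≤s j≤k)   = *-pres-∣ (∣-refl {m}) (^-monoʳ-∣ m j≤k)

¬∣⇒>0 : ∀ {d n} → ¬ d ∣ n → n > 0
¬∣⇒>0 {n = zero}  d∤0 = contradiction (divides 0 refl) d∤0
¬∣⇒>0 {n = suc _} _   = s≤s z≤n

isNonzero : ℕ → ℕ
isNonzero x = if x ≡ᵇ 0 then 0 else 1

module Digits (b : ℕ) .{{_ : NonZero b}} (1<b : 1 < b) where

  nonzeroDigit : ℕ → ℕ
  nonzeroDigit n = isNonzero (n % b)

  n/b<n : ∀ n .{{_ : NonZero n}} → n / b < n
  n/b<n n = m/n<m n b 1<b

  nzDigitsAux-fuel : ∀ f g n → n ≤ f → n ≤ g → nzDigitsAux b f n ≡ nzDigitsAux b g n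
  nzDigitsAux-fuel zero    zero    zero    _ _ = refl
  nzDigitsAux-fuel zero    (suc g) zero    _ _ = refl
  nzDigitsAux-fuel (suc f) zero    zero    _ _ = refl
  nzDigitsAux-fuel (suc f) (suc g) zero    _ _ = refl
  nzDigitsAux-fuel (suc f) (suc g) n@(suc k) (s≤s k≤f) (s≤s k≤g) =
    cong (nonzeroDigit n +_)
         (nzDigitsAux-fuel f g (n / b) (≤-trans n/b≤k k≤f) (≤-trans n/b≤k k≤g))
    where n/b≤k = <⇒≤pred (n/b<n n)

  c-unfold : ∀ n → c b n ≡ nonzeroDigit n + c b (n / b)
  c-unfold zero =
    sym (cong₂ (λ d q → d + c b q) (cong isNonzero (m*n%n≡0 0 b)) (0/n≡0 b))
  c-unfold n@(suc k) =
    cong (nonzeroDigit n +_) (nzDigitsAux-fuel k (n / b) (n / b) (<⇒≤pred (n/b<n n)) ≤-refl)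

  c-pos : ∀ n → 1 ≤ n → 1 ≤ c b n
  c-pos = <-rec (λ n → 1 ≤ n → 1 ≤ c b n) step
    where
    step : ∀ n → (∀ {m} → m < n → 1 ≤ m → 1 ≤ c b m) → 1 ≤ n → 1 ≤ c b n
    step n@(suc _) rec _ with n <? b
    ... | yes n<b rewrite c-unfold n | m<n⇒m%n≡m n<b = s≤s z≤n
    ... | no  n≮b rewrite c-unfold n =
      ≤-trans (rec (n/b<n n) (m≥n⇒m/n>0 (≮⇒≥ n≮b))) (m≤n+m _ (nonzeroDigit n))

  -- N mod b^k keeps the last k digits of N, and N ≥ b^k has a nonzero digit
  -- beyond them.
  c-%-pow< : ∀ k N .{{_ : NonZero (b ^ k)}} → b ^ k ≤ N → suc (c b (N % b ^ k)) ≤ c b N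
  c-%-pow< zero N 1≤N rewrite n%1≡0 N = c-pos N 1≤N
  c-%-pow< (suc k) N bᵏ⁺¹≤N = begin
      suc (c b r)
    ≡⟨ cong suc (c-unfold r) ⟩
      suc (nonzeroDigit r + c b (r / b))
    ≡⟨ cong suc (cong₂ (λ d q → d + c b q) same-digit same-quotient) ⟩
      suc (nonzeroDigit N + c b (N / b % b ^ k))
    ≡⟨ +-suc (nonzeroDigit N) _ ⟨
      nonzeroDigit N + suc (c b (N / b % b ^ k))
    ≤⟨ +-monoʳ-≤ (nonzeroDigit N) (c-%-pow< k (N / b) bᵏ≤N/b) ⟩
      nonzeroDigit N + c b (N / b)
    ≡⟨ c-unfold N ⟨
      c b N ∎
    where
    open ≤-Reasoning
    r = N % b ^ suc k
    instance
      bᵏ≢0 = m^n≢0 b k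
      bᵏb≢0 = m*n≢0 (b ^ k) b
    same-digit : nonzeroDigit r ≡ nonzeroDigit N
    same-digit = cong isNonzero (m∣n⇒o%n%m≡o%m b (b ^ suc k) N (m∣m*n (b ^ k)))
    same-quotient : r / b ≡ N / b % b ^ k
    same-quotient = begin-equality
        N % (b * b ^ k) / b  ≡⟨ /-congˡ (%-congʳ (*-comm b (b ^ k))) ⟩
        N % (b ^ k * b) / b  ≡⟨ m%[n*o]/o≡m/o%n N (b ^ k) b ⟩
        N / b % b ^ k        ∎
    bᵏ≤N/b : b ^ k ≤ N / b
    bᵏ≤N/b = begin
        b ^ k          ≡⟨ m*n/n≡m (b ^ k) b ⟨
        b ^ k * b / b  ≡⟨ cong (_/ b) (*-comm (b ^ k) b) ⟩
        b ^ suc k / b  ≤⟨ /-monoˡ-≤ b bᵏ⁺¹≤N ⟩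
        N / b          ∎

open Digits 10 (s≤s (s≤s z≤n))

module Sequence (e : ℕ → ℕ) (e₁-pos : 1 ≤ e 1)
                (gap : ∀ j → 10 ^ e (suc j) < 2 ^ e (suc (suc j))) where

  e-increasing : ∀ j → e (suc j) < e (suc (suc j))
  e-increasing j = ≰⇒> λ e₊≤e → <⇒≱ (gap j)
    (≤-trans (^-monoʳ-≤ 2 e₊≤e) (^-monoˡ-≤ (e (suc j)) (s≤s (s≤s z≤n))))

  e-pos : ∀ j → 1 ≤ e (suc j)
  e-pos zero    = e₁-pos
  e-pos (suc j) = ≤-<-trans z≤n (e-increasing j)

  c-lower : ∀ j N → 2 ^ e (suc j) ∣ N → ¬ 10 ∣ N → suc j ≤ c 10 N
  c-lower zero N _ 10∤N = c-pos N (¬∣⇒>0 10∤N)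
  c-lower (suc j) N 2ᵉ∣N 10∤N = begin
      suc (suc j)       ≤⟨ s≤s (c-lower j r 2ᵐ∣r 10∤r) ⟩
      suc (c 10 r)      ≤⟨ c-%-pow< m N 10ᵐ≤N ⟩
      c 10 N            ∎
    where
    open ≤-Reasoning
    m = e (suc j)
    instance 10ᵐ≢0 = m^n≢0 10 m
    r = N % 10 ^ m
    2ᵐ∣r : 2 ^ m ∣ r
    2ᵐ∣r = %-presˡ-∣ (∣-trans (^-monoʳ-∣ 2 (<⇒≤ (e-increasing j))) 2ᵉ∣N)
                     (^-monoˡ-∣ m (divides 5 refl))
    10∤r : ¬ 10 ∣ r
    10∤r 10∣r = 10∤N (∣n∣m%n⇒∣m (^-monoʳ-∣ 10 (e-pos j)) 10∣r)
    10ᵐ≤N : 10 ^ m ≤ N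
    10ᵐ≤N = ≤-trans (<⇒≤ (gap j)) (∣⇒≤ {{>-nonZero (¬∣⇒>0 10∤N)}} 2ᵉ∣N)

theorem3p1 : (e : ℕ → ℕ) → 1 ≤ e 1
    → (∀ k → 2 ≤ k → 10 ^ e (k ∸ 1) < 2 ^ e k)
    → ∀ (k N : ℕ) → 1 ≤ k → 1 ≤ N → 2 ^ e k ∣ N → ¬ (10 ∣ N)
    → c 10 N ≥ k
theorem3p1 e e₁-pos gap (suc j) N _ _ =
  Sequence.c-lower e e₁-pos (λ i → gap (suc (suc i)) (s≤s (s≤s z≤n))) j N
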